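{- Let $G$ be an $\alpha$-weakly-Helly graph and $M\subseteq V(G)$. For every $x\in V(G)$ and every $y\in F_G^M(x)$, $$e_G^M(y)\ge 2rad_G(M)-diam_G(C_G^{2\alpha}(M))-2\alpha\quad\text{and}\quad e_G^M(y)\ge 2rad_G(M)-diam_G(C_G^{\alpha}(M))-4\alpha.$$
   Context: All graphs are finite, simple, undirected, unweighted and connected. A graph $G$ is $\alpha$-weakly-Helly if for every family of pairwise intersecting disks $\{D_G(v,r(v)) : v\in S\}$ (where $D_G(v,r)=\{u: d_G(u,v)\le r\}$) the disks $D_G(v,r(v)+\alpha)$, $v\in S$, have a common vertex. For $M\subseteq V(G)$ and $v\in V(G)$: $e_G^M(v)=\max_{u\in M}d_G(v,u)$, $F_G^M(v)=\{u\in M: d_G(v,u)=e_G^M(v)\}$, $rad_G(M)=\min_{v\in V(G)}e_G^M(v)$, $C_G^{\ell}(M)=\{v: e_G^M(v)\le rad_G(M)+\ell\}$, and for $S\subseteq V(G)$, $diam_G(S)=\max_{u,v\in S}d_G(u,v)$. -}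

module Defs where

open import Data.Nat using (ℕ; zero; suc; _+_; _*_; _∸_; _≤_; _⊔_; _⊓_)
open import Data.Nat.Properties using (_≤?_)
open import Data.Bool using (Bool; true; false; _∨_; _∧_; if_then_else_)
open import Data.Fin using (Fin)
open import Data.Fin.Properties using (_≟_)
open import Data.Fin.Subset using (Subset; _∈_)
open import Data.Vec using (lookup)
open import Data.List using (List; allFin; foldr)
open import Data.Bool.ListAction using (any)
open import Data.Product using (Σ; ∃; _×_; ∃-syntax)
open import Relation.Binary.PropositionalEquality using (_≡_)
open import Relation.Nullary.Decidable using (⌊_⌋)

record Graph : Set where
  field
    n      : ℕ
    adj    : Fin n → Fin n → Bool
    sym    : ∀ u v → adj u v ≡ adj v u
    irrefl : ∀ v → adj v v ≡ false

module _ (G : Graph) where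
  open Graph G

  V : Set
  V = Fin n

  data Walk : V → V → ℕ → Set where
    here : ∀ {v} → Walk v v zero
    step : ∀ {u w v k} → adj u w ≡ true → Walk w v k → Walk u v (suc k)

  Connected : Set
  Connected = ∀ (u v : V) → ∃[ k ] Walk u v k

  reach : ℕ → V → V → Bool
  reach zero    u v = ⌊ u ≟ v ⌋
  reach (suc k) u v = reach k u v ∨ any (λ w → reach k u w ∧ adj w v) (allFin n)

  -- least i < b with p i, or b if there is none
  search : (ℕ → Bool) → ℕ → ℕ
  search p zero    = zero
  search p (suc b) = if p zero then zero else suc (search (λ i → p (suc i)) b)

  -- shortest-path distance (correct for connected graphs, since any
  -- two vertices are then joined by a walk with fewer than n edges)
  dist : V → V → ℕ
  dist u v = search (λ k → reach k u v) n

  Disk : V → ℕ → V → Set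
  Disk v r u = dist u v ≤ r

  WeaklyHelly : ℕ → Set
  WeaklyHelly α =
    (S : Subset n) (r : V → ℕ) →
    (∀ v w → v ∈ S → w ∈ S → ∃[ u ] (Disk v (r v) u × Disk w (r w) u)) →
    ∃[ z ] (∀ v → v ∈ S → Disk v (r v + α) z)

  ecc : Subset n → V → ℕ
  ecc M v = foldr (λ u acc → if lookup M u then dist v u ⊔ acc else acc) 0 (allFin n)

  Far : Subset n → V → V → Set
  Far M v u = u ∈ M × dist v u ≡ ecc M v

  -- rad(M) = min_{v ∈ V} e^M(v)   (initial value n is ≥ every eccentricity,
  -- since dist ≤ n by construction, so it does not affect the minimum when n ≥ 1)
  rad : Subset n → ℕ
  rad M = foldr (λ v acc → ecc M v ⊓ acc) n (allFin n)

  center : Subset n → ℕ → V → Bool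
  center M ℓ v = ⌊ ecc M v ≤? rad M + ℓ ⌋

  diam : (V → Bool) → ℕ
  diam S = foldr (λ u acc → foldr (λ v acc' → if S u ∧ S v then dist u v ⊔ acc' else acc') acc (allFin n)) 0 (allFin n)

-- Write r = rad(M) and e = e^M.  The heart of the proof is the lemma
-- `close-to-center`: every vertex v lies within distance e(v) − r + α of some
-- vertex z with e(z) ≤ r + α.  It follows from the weak Helly property applied
-- to the disks D(u, r), u ∈ M, together with D(v, e(v) − r): two disks around
-- M meet at a central vertex, and D(v, e(v) − r) meets D(u, r) because
-- d(v,u) ≤ e(v), so a shortest v–u path can be cut at distance e(v) − r.
-- Given y ∈ F(x), pick such z_x, z_y; both lie in C^ℓ(M) for every ℓ ≥ α, so
--   e(x) = d(x,y) ≤ (e(x) − r + α) + diam C^ℓ(M) + (e(y) − r + α),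
-- which rearranges to e(y) ≥ 2r − diam C^ℓ(M) − 2α.  Taking ℓ = 2α gives the
-- first inequality, ℓ = α (and 2α ≤ 4α) the second.

module Submission where

open import Defs
open import Data.Nat using (ℕ; zero; suc; pred; _≤?_; _+_; _*_; _∸_; _≤_; _<_; _≥_; _⊔_; _⊓_; z≤n; s≤s)
open import Data.Nat.Properties
  using ( ≤-refl; ≤-trans; ≤-antisym; ≤-<-trans; <-≤-trans; <-irrefl; ≤-pred; m≤n⇒m≤1+n
        ; +-comm; +-assoc; +-identityʳ; +-suc; +-mono-≤; +-monoˡ-≤; +-monoʳ-≤; +-cancelˡ-≤
        ; m≤m+n; m≤n⇒∃[o]m+o≡n; ≰⇒>; <⇒≤; <⇒≤pred; m∸n+n≡m; m≤n+o⇒m∸n≤o; ∸-monoʳ-≤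
        ; *-monoˡ-≤; m≤m⊔n; m≤n⊔m; ⊔-lub; m⊓n≤m; m⊓n≤n; ⊓-sel; module ≤-Reasoning )
open import Data.Bool using (Bool; true; false; T; _∧_; if_then_else_)
open import Data.Bool.Properties using (T-∨; T-∧; T-≡)
open import Data.Fin.Properties using (_≟_; toℕ<n; all?; ¬∀⟶∃¬)
open import Data.Fin.Subset using (Subset; _∈_; _⊂_; _∪_; ⁅_⁆; ∣_∣)
open import Data.Fin.Subset.Properties
  using (p⊂q⇒∣p∣<∣q∣; x∈p⇒∣p-x∣<∣p∣; ∣p∣≤n; x∈p∪q⁺; x∈p∪q⁻; x∈⁅x⁆; x∈⁅y⁆⇒x≡y)
open import Data.Vec using (tabulate; lookup)
open import Data.Vec.Properties using (lookup⇒[]=; []=⇒lookup; lookup∘tabulate)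
open import Data.List using (List; []; _∷_; allFin; foldr)
import Data.List.Membership.Propositional as List
open import Data.List.Membership.Propositional.Properties using (∈-allFin)
open import Data.List.Relation.Unary.Any using (here; there; satisfied)
open import Data.List.Relation.Unary.Any.Properties using (any⁺; any⁻)
open import Data.Product using (_×_; ∃-syntax; _,_)
open import Data.Sum using (_⊎_; inj₁; inj₂)
open import Data.Empty using (⊥-elim)
open import Function.Bundles using (Equivalence)
open import Relation.Nullary using (¬_; Dec; yes; no)
open import Relation.Nullary.Decidable using (⌊_⌋; T?; _→-dec_)
open import Relation.Binary.PropositionalEquality using (_≡_; refl; sym; trans; subst; subst₂; cong; ≢-sym)
open import Data.Nat.Tactic.RingSolver using (solve-∀)

¬-implies : ∀ a b → ¬ (T a → T b) → T a × ¬ T b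
¬-implies true  b  ¬a→b = _ , λ tb → ¬a→b (λ _ → tb)
¬-implies false b  ¬a→b = ⊥-elim (¬a→b λ ())

T⇒≡ : ∀ {b} → T b → b ≡ true
T⇒≡ = Equivalence.to T-≡

≡⇒T : ∀ {b} → b ≡ true → T b
≡⇒T = Equivalence.from T-≡

search-≤ : ∀ G p b → search G p b ≤ b
search-≤ G p zero = z≤n
search-≤ G p (suc b) with p zero
... | true  = z≤n
... | false = s≤s (search-≤ G (λ i → p (suc i)) b)

search-min : ∀ G p b k → T (p k) → search G p b ≤ k
search-min G p zero    k       pk = z≤n
search-min G p (suc b) zero    pk with p zero
... | true  = z≤n
search-min G p (suc b) (suc k) pk with p zero
... | true  = z≤n
... | false = s≤s (search-min G (λ i → p (suc i)) b k pk)

search-hit : ∀ G p b → search G p b < b → T (p (search G p b))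
search-hit G p (suc b) lt with p zero in eq
... | true  = ≡⇒T eq
... | false = search-hit G (λ i → p (suc i)) b (≤-pred lt)

-- Walks that grow at their end, matching the recursion of `reach`

module Walks (G : Graph) where
  open Graph G using (adj) renaming (sym to adj-sym)

  data SnocWalk : V G → V G → ℕ → Set where
    []  : ∀ {u} → SnocWalk u u zero
    _▷_ : ∀ {u w v k} → SnocWalk u w k → adj w v ≡ true → SnocWalk u v (suc k)

  _◁_ : ∀ {u w v k} → adj u w ≡ true → SnocWalk w v k → SnocWalk u v (suc k)
  e ◁ []       = [] ▷ e
  e ◁ (p ▷ e') = (e ◁ p) ▷ e'

  reverse : ∀ {u v k} → SnocWalk u v k → SnocWalk v u k
  reverse []                  = []
  reverse (_▷_ {w = w} {v} p e) = trans (adj-sym v w) e ◁ reverse p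

  fromWalk : ∀ {u v k} → Walk G u v k → SnocWalk u v k
  fromWalk here       = []
  fromWalk (step e w) = e ◁ fromWalk w

  _++_ : ∀ {u v w a b} → SnocWalk u v a → SnocWalk v w b → SnocWalk u w (b + a)
  p ++ []      = p
  p ++ (q ▷ e) = (p ++ q) ▷ e

  splitAt : ∀ {u w} a b → SnocWalk u w (b + a) → ∃[ v ] (SnocWalk u v a × SnocWalk v w b)
  splitAt a zero    p       = _ , p , []
  splitAt a (suc b) (p ▷ e) with splitAt a b p
  ... | v , p₁ , p₂ = v , p₁ , p₂ ▷ e

-- Boolean reachability `reach k u v` means: a walk of length ≤ k from u to v

module Reachability (G : Graph) where
  open Graph G using (n; adj)
  open Walks G

  Reach : ℕ → V G → V G → Set
  Reach k u v = ∃[ j ] (j ≤ k × SnocWalk u v j)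

  reach-self : ∀ u → T (reach G zero u u)
  reach-self u with u ≟ u
  ... | yes _  = _
  ... | no u≢u = u≢u refl

  reach-suc : ∀ k {u v} → T (reach G k u v) → T (reach G (suc k) u v)
  reach-suc k r = Equivalence.from T-∨ (inj₁ r)

  reach-edge : ∀ k {u w v} → T (reach G k u w) → adj w v ≡ true → T (reach G (suc k) u v)
  reach-edge k {u} {w} {v} r e =
    Equivalence.from T-∨ (inj₂ (any⁺ _ (List.lose (∈-allFin w) (Equivalence.from T-∧ (r , ≡⇒T e)))))

  reach-mono : ∀ {j k u v} → j ≤ k → T (reach G j u v) → T (reach G k u v)
  reach-mono {j} j≤k r with m≤n⇒∃[o]m+o≡n j≤k
  ... | o , refl = go o
    where
      go : ∀ o → T (reach G (j + o) _ _)
      go zero    rewrite +-identityʳ j = r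
      go (suc o) rewrite +-suc j o     = reach-suc (j + o) (go o)

  reach-suc⁻ : ∀ k {u v} → T (reach G (suc k) u v) →
               T (reach G k u v) ⊎ ∃[ w ] (T (reach G k u w) × adj w v ≡ true)
  reach-suc⁻ k {u} {v} r with Equivalence.to T-∨ r
  ... | inj₁ r′ = inj₁ r′
  ... | inj₂ r′ with satisfied (any⁻ (λ w → reach G k u w ∧ adj w v) (allFin n) r′)
  ...   | w , rw∧e with Equivalence.to T-∧ rw∧e
  ...     | rw , e = inj₂ (w , rw , T⇒≡ e)

  reach-sound : ∀ k {u v} → T (reach G k u v) → Reach k u v
  reach-sound zero {u} {v} r with u ≟ v
  ... | yes refl = 0 , z≤n , []
  reach-sound (suc k) r with reach-suc⁻ k r
  ... | inj₁ r′ with reach-sound k r′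
  ...   | j , j≤k , p = j , m≤n⇒m≤1+n j≤k , p
  reach-sound (suc k) r | inj₂ (w , rw , e) with reach-sound k rw
  ...   | j , j≤k , p = suc j , s≤s j≤k , p ▷ e

  walk-reach : ∀ {u v j} → SnocWalk u v j → T (reach G j u v)
  walk-reach {u} []              = reach-self u
  walk-reach {j = suc j} (p ▷ e) = reach-edge j (walk-reach p) e

  reach-complete : ∀ {k u v} → Reach k u v → T (reach G k u v)
  reach-complete (j , j≤k , p) = reach-mono j≤k (walk-reach p)

  -- Saturation: once one more step reaches nothing new, nothing new is ever
  -- reached.  Reachable sets grow strictly until they saturate, so by
  -- counting they saturate after fewer than n steps.
  Saturated : V G → ℕ → Set
  Saturated u j = ∀ v → T (reach G (suc j) u v) → T (reach G j u v)

  saturated-suc : ∀ {u j} → Saturated u j → Saturated u (suc j)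
  saturated-suc {u} {j} sat v r with reach-suc⁻ (suc j) r
  ... | inj₁ r′             = r′
  ... | inj₂ (w , rw , e) = reach-edge j (sat w rw) e

  saturated-later : ∀ {u j} → Saturated u j → ∀ o → Saturated u (o + j)
  saturated-later         sat zero    = sat
  saturated-later {u} {j} sat (suc o) = saturated-suc {u} {o + j} (saturated-later sat o)

  saturated-forever : ∀ {u j} → Saturated u j → ∀ o {v} → T (reach G (o + j) u v) → T (reach G j u v)
  saturated-forever         sat zero    r = r
  saturated-forever {u} {j} sat (suc o) r = saturated-forever sat o (saturated-later {u} {j} sat o _ r)

  reached : ℕ → V G → Subset n
  reached k u = tabulate (reach G k u)

  ∈-reached⁺ : ∀ k u {v} → T (reach G k u v) → v ∈ reached k u
  ∈-reached⁺ k u {v} r = lookup⇒[]= v (reached k u) (trans (lookup∘tabulate (reach G k u) v) (T⇒≡ r))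

  ∈-reached⁻ : ∀ k u {v} → v ∈ reached k u → T (reach G k u v)
  ∈-reached⁻ k u {v} m = ≡⇒T (trans (sym (lookup∘tabulate (reach G k u) v)) ([]=⇒lookup m))

  saturated? : ∀ u k → Dec (Saturated u k)
  saturated? u k = all? (λ v → T? (reach G (suc k) u v) →-dec T? (reach G k u v))

  unsaturated-grows : ∀ u k → ¬ Saturated u k → reached k u ⊂ reached (suc k) u
  unsaturated-grows u k ¬sat
    with ¬∀⟶∃¬ n _ (λ v → T? (reach G (suc k) u v) →-dec T? (reach G k u v)) ¬sat
  ... | v , ¬step with ¬-implies (reach G (suc k) u v) (reach G k u v) ¬step
  ...   | new , ¬old =
    (λ m → ∈-reached⁺ (suc k) u (reach-suc k (∈-reached⁻ k u m)))
    , v , ∈-reached⁺ (suc k) u new , (λ m → ¬old (∈-reached⁻ k u m))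

  grows-or-saturates : ∀ u k → (∃[ j ] (j < k × Saturated u j)) ⊎ k < ∣ reached k u ∣
  grows-or-saturates u zero = inj₂ (≤-<-trans z≤n (x∈p⇒∣p-x∣<∣p∣ (∈-reached⁺ 0 u (reach-self u))))
  grows-or-saturates u (suc k) with grows-or-saturates u k | saturated? u k
  ... | inj₁ (j , j<k , sat) | _        = inj₁ (j , m≤n⇒m≤1+n j<k , sat)
  ... | inj₂ _               | yes sat = inj₁ (k , ≤-refl , sat)
  ... | inj₂ k<∣A∣           | no ¬sat = inj₂ (<-≤-trans (s≤s k<∣A∣) (p⊂q⇒∣p∣<∣q∣ (unsaturated-grows u k ¬sat)))

  saturates-early : ∀ u → ∃[ j ] (j < n × Saturated u j)
  saturates-early u with grows-or-saturates u n
  ... | inj₁ sat   = sat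
  ... | inj₂ n<∣A∣ = ⊥-elim (<-irrefl refl (<-≤-trans n<∣A∣ (∣p∣≤n (reached n u))))

  reach-all : Connected G → ∀ u v → T (reach G (pred n) u v)
  reach-all conn u v with conn u v | saturates-early u
  ... | k , w | j , j<n , sat =
    reach-mono (<⇒≤pred j<n)
      (saturated-forever sat k (reach-mono (m≤m+n k j) (walk-reach (fromWalk w))))

-- On a connected graph, `dist` is the path metric

module Metric (G : Graph) (conn : Connected G) where
  open Graph G using (n)
  open Walks G
  open Reachability G

  dist<n : ∀ u v → dist G u v < n
  dist<n u v = ≤pred⇒< (toℕ<n u) (search-min G _ n (pred n) (reach-all conn u v))
    where
      ≤pred⇒< : ∀ {i m k} → i < k → m ≤ pred k → m < k
      ≤pred⇒< {k = suc _} _ m≤k = s≤s m≤k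

  dist⇒reach : ∀ {k u v} → dist G u v ≤ k → Reach k u v
  dist⇒reach {k} {u} {v} d≤k = reach-sound k (reach-mono d≤k (search-hit G _ n (dist<n u v)))

  reach⇒dist : ∀ {k u v} → Reach k u v → dist G u v ≤ k
  reach⇒dist {k} r = search-min G _ n k (reach-complete r)

  dist-self : ∀ u k → dist G u u ≤ k
  dist-self u k = reach⇒dist (0 , z≤n , [])

  dist-sym : ∀ u v → dist G u v ≡ dist G v u
  dist-sym u v = ≤-antisym (sym-≤ u v) (sym-≤ v u)
    where
      sym-≤ : ∀ u v → dist G u v ≤ dist G v u
      sym-≤ u v with dist⇒reach {dist G v u} ≤-refl
      ... | j , j≤d , p = reach⇒dist (j , j≤d , reverse p)

  dist-triangle : ∀ u v w → dist G u w ≤ dist G u v + dist G v w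
  dist-triangle u v w with dist⇒reach {dist G u v} ≤-refl | dist⇒reach {dist G v w} ≤-refl
  ... | a , a≤ , p | b , b≤ , q =
    reach⇒dist (b + a , subst (_≤ dist G u v + dist G v w) (+-comm a b) (+-mono-≤ a≤ b≤) , p ++ q)

  -- D(u,a) and D(w,b) meet as soon as d(u,w) ≤ a + b: cut a shortest path
  disks-meet : ∀ u w a b → dist G u w ≤ a + b → ∃[ z ] (Disk G u a z × Disk G w b z)
  disks-meet u w a b d≤a+b with dist⇒reach d≤a+b
  ... | j , j≤a+b , p with j ≤? a
  ...   | yes j≤a = w , reach⇒dist (j , j≤a , reverse p) , dist-self w b
  ...   | no j≰a with m≤n⇒∃[o]m+o≡n (<⇒≤ (≰⇒> j≰a))
  ...     | c , refl with splitAt a c (subst (SnocWalk u w) (+-comm a c) p)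
  ...       | z , p₁ , p₂ =
    z , reach⇒dist (a , ≤-refl , reverse p₁) , reach⇒dist (c , +-cancelˡ-≤ a c b j≤a+b , p₂)

module InflationaryFold {A : Set} (g : A → ℕ → ℕ) (inflationary : ∀ x a → a ≤ g x a) where

  fold-≥-init : ∀ a xs → a ≤ foldr g a xs
  fold-≥-init a []       = ≤-refl
  fold-≥-init a (x ∷ xs) = ≤-trans (fold-≥-init a xs) (inflationary x _)

  fold-≥-step : ∀ {x m} a xs → x List.∈ xs → (∀ b → m ≤ g x b) → m ≤ foldr g a xs
  fold-≥-step a (x ∷ xs) (here refl) m≤g = m≤g _
  fold-≥-step a (y ∷ xs) (there x∈)  m≤g = ≤-trans (fold-≥-step a xs x∈ m≤g) (inflationary y _)

guardedMax : {A : Set} → (A → Bool) → (A → ℕ) → A → ℕ → ℕ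
guardedMax p f x a = if p x then f x ⊔ a else a

guardedMax-inflationary : ∀ {A : Set} (p : A → Bool) f x a → a ≤ guardedMax p f x a
guardedMax-inflationary p f x a with p x
... | true  = m≤n⊔m (f x) a
... | false = ≤-refl

guardedMax-≥ : ∀ {A : Set} (p : A → Bool) f {x} → p x ≡ true → ∀ a → f x ≤ guardedMax p f x a
guardedMax-≥ p f {x} px a rewrite px = m≤m⊔n (f x) a

guardedMax-≤ : ∀ {A : Set} (p : A → Bool) f {k} → (∀ x → p x ≡ true → f x ≤ k) →
               ∀ {a} → a ≤ k → ∀ xs → foldr (guardedMax p f) a xs ≤ k
guardedMax-≤ p f bound a≤k []       = a≤k
guardedMax-≤ p f bound a≤k (x ∷ xs) with p x in px
... | true  = ⊔-lub (bound x px) (guardedMax-≤ p f bound a≤k xs)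
... | false = guardedMax-≤ p f bound a≤k xs

module MinFold {A : Set} (f : A → ℕ) where

  minFold : ℕ → List A → ℕ
  minFold = foldr (λ x m → f x ⊓ m)

  minFold-≤ : ∀ {x} a xs → x List.∈ xs → minFold a xs ≤ f x
  minFold-≤ a (x ∷ xs) (here refl) = m⊓n≤m (f x) (minFold a xs)
  minFold-≤ a (y ∷ xs) (there x∈)  = ≤-trans (m⊓n≤n (f y) (minFold a xs)) (minFold-≤ a xs x∈)

  minFold-attained : ∀ a xs → minFold a xs ≡ a ⊎ ∃[ x ] minFold a xs ≡ f x
  minFold-attained a []       = inj₁ refl
  minFold-attained a (y ∷ xs) with ⊓-sel (f y) (minFold a xs)
  ... | inj₁ eq = inj₂ (y , eq)
  ... | inj₂ eq with minFold-attained a xs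
  ...   | inj₁ eq′       = inj₁ (trans eq eq′)
  ...   | inj₂ (x , eq′) = inj₂ (x , trans eq eq′)

module Eccentricity (G : Graph) (conn : Connected G) (M : Subset (Graph.n G)) where
  open Graph G using (n)
  open Metric G conn

  ecc-≥ : ∀ v {u} → u ∈ M → dist G v u ≤ ecc G M v
  ecc-≥ v {u} u∈M = InflationaryFold.fold-≥-step (guardedMax (lookup M) (dist G v))
    (guardedMax-inflationary (lookup M) (dist G v)) 0 (allFin n) (∈-allFin u)
    (guardedMax-≥ (lookup M) (dist G v) ([]=⇒lookup u∈M))

  ecc-≤ : ∀ v {k} → (∀ u → u ∈ M → dist G v u ≤ k) → ecc G M v ≤ k
  ecc-≤ v bound = guardedMax-≤ (lookup M) (dist G v)
    (λ u Mu → bound u (lookup⇒[]= u M Mu)) z≤n (allFin n)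

  rad-≤ : ∀ v → rad G M ≤ ecc G M v
  rad-≤ v = MinFold.minFold-≤ (ecc G M) n (allFin n) (∈-allFin v)

  -- the radius is the eccentricity of some vertex (the initial value n of
  -- the fold is no smaller than any eccentricity)
  rad-attained : V G → ∃[ c ] ecc G M c ≤ rad G M
  rad-attained v with MinFold.minFold-attained (ecc G M) n (allFin n)
  ... | inj₁ eq       = v , subst (ecc G M v ≤_) (sym eq) (ecc-≤ v (λ u _ → search-≤ G _ n))
  ... | inj₂ (c , eq) = c , subst (ecc G M c ≤_) (sym eq) ≤-refl

  -- any two vertices of M are within 2·rad(M) of each other, via a central vertex
  M-within-2rad : ∀ {u w} → u ∈ M → w ∈ M → dist G u w ≤ rad G M + rad G M
  M-within-2rad {u} {w} u∈M w∈M with rad-attained u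
  ... | c , ec≤r = ≤-trans (dist-triangle u c w)
    (+-mono-≤ (subst (_≤ rad G M) (dist-sym c u) (≤-trans (ecc-≥ c u∈M) ec≤r))
              (≤-trans (ecc-≥ c w∈M) ec≤r))

  -- diam(S) is a maximum of row maxima, the row of u ranging over v ∈ S
  diam-≥ : ∀ S {u v} → S u ≡ true → S v ≡ true → dist G u v ≤ diam G S
  diam-≥ S {u} {v} Su Sv =
    InflationaryFold.fold-≥-step row row-inflationary 0 (allFin n) (∈-allFin u) entry≤row
    where
      pairStep : V G → V G → ℕ → ℕ
      pairStep u = guardedMax (λ v → S u ∧ S v) (dist G u)

      row : V G → ℕ → ℕ
      row u a = foldr (pairStep u) a (allFin n)

      row-inflationary : ∀ u a → a ≤ row u a
      row-inflationary u a = InflationaryFold.fold-≥-init (pairStep u)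
        (guardedMax-inflationary (λ v → S u ∧ S v) (dist G u)) a (allFin n)

      entry≤row : ∀ b → dist G u v ≤ row u b
      entry≤row b = InflationaryFold.fold-≥-step (pairStep u)
        (guardedMax-inflationary (λ v → S u ∧ S v) (dist G u)) b (allFin n) (∈-allFin v)
        (guardedMax-≥ (λ v → S u ∧ S v) (dist G u) (subst (λ s → s ∧ S v ≡ true) (sym Su) Sv))

  ∈-center : ∀ ℓ {c} → ecc G M c ≤ rad G M + ℓ → center G M ℓ c ≡ true
  ∈-center ℓ {c} ec≤ with ecc G M c ≤? rad G M + ℓ
  ... | yes _   = refl
  ... | no ec≰  = ⊥-elim (ec≰ ec≤)

-- The weak Helly argument

-- With r = rad(M), e = e^M and D = diam(C^ℓ(M)) for some ℓ ≥ α: the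
-- triangle inequality along x, z_x, z_y, y gives
-- e(x) ≤ (e(x) − r) + (D + (2α + (e(y) − r))), and this rearranges as follows.
excess-arith : ∀ {r a b D t} → r ≤ a → r ≤ b → a ≤ (a ∸ r) + (D + (t + (b ∸ r))) → 2 * r ∸ D ∸ t ≤ b
excess-arith {r} {a} {b} {D} {t} r≤a r≤b a≤ =
  m≤n+o⇒m∸n≤o (2 * r ∸ D) t (m≤n+o⇒m∸n≤o (2 * r) D 2r≤)
  where
    open ≤-Reasoning
    r≤ : r ≤ D + (t + (b ∸ r))
    r≤ = +-cancelˡ-≤ (a ∸ r) r _ (subst (_≤ (a ∸ r) + (D + (t + (b ∸ r)))) (sym (m∸n+n≡m r≤a)) a≤)

    2r≤ : 2 * r ≤ D + (t + b)
    2r≤ = begin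
      2 * r                       ≡⟨ cong (r +_) (+-identityʳ r) ⟩
      r + r                       ≤⟨ +-monoˡ-≤ r r≤ ⟩
      D + (t + (b ∸ r)) + r       ≡⟨ +-assoc D (t + (b ∸ r)) r ⟩
      D + ((t + (b ∸ r)) + r)     ≡⟨ cong (D +_) (+-assoc t (b ∸ r) r) ⟩
      D + (t + ((b ∸ r) + r))     ≡⟨ cong (λ s → D + (t + s)) (m∸n+n≡m r≤b) ⟩
      D + (t + b)                 ∎

regroup : ∀ a α D b → (a + α) + (D + (b + α)) ≡ a + (D + (2 * α + b))
regroup = solve-∀

module HellyCenter (G : Graph) (conn : Connected G) (α : ℕ) (helly : WeaklyHelly G α)
                   (M : Subset (Graph.n G)) where
  open Graph G using (n)
  open Metric G conn
  open Eccentricity G conn M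

  r : ℕ
  r = rad G M

  e : V G → ℕ
  e = ecc G M

  module DisksAround (v : V G) where
    centres : Subset n
    centres = M ∪ ⁅ v ⁆

    radius : V G → ℕ
    radius w = if ⌊ w ≟ v ⌋ then e v ∸ r else r

    radius-v : radius v ≡ e v ∸ r
    radius-v with v ≟ v
    ... | yes _  = refl
    ... | no v≢v = ⊥-elim (v≢v refl)

    radius-other : ∀ {w} → ¬ w ≡ v → radius w ≡ r
    radius-other {w} w≢v with w ≟ v
    ... | yes w≡v = ⊥-elim (w≢v w≡v)
    ... | no _    = refl

    centre-in-M : ∀ {w} → w ∈ centres → ¬ w ≡ v → w ∈ M
    centre-in-M {w} w∈ w≢v with x∈p∪q⁻ M ⁅ v ⁆ w∈
    ... | inj₁ w∈M = w∈M
    ... | inj₂ w∈v = ⊥-elim (w≢v (x∈⁅y⁆⇒x≡y v w∈v))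

    -- the radius at a vertex of M is at most r, since e(v) ≤ 2r when v ∈ M
    radius-M : ∀ {u} → u ∈ M → radius u ≤ r
    radius-M {u} u∈M with u ≟ v
    ... | yes refl = m≤n+o⇒m∸n≤o (e u) r (ecc-≤ u (λ w w∈M → M-within-2rad u∈M w∈M))
    ... | no _     = ≤-refl

    centre-to-M : ∀ {w u} → w ∈ centres → u ∈ M → dist G w u ≤ radius w + r
    centre-to-M {w} {u} w∈ u∈M with w ≟ v
    ... | yes refl = subst (dist G w u ≤_) (sym (m∸n+n≡m (rad-≤ w))) (ecc-≥ w u∈M)
    ... | no w≢v   = M-within-2rad (centre-in-M w∈ w≢v) u∈M

    centres-close : ∀ {w w′} → w ∈ centres → w′ ∈ centres → dist G w w′ ≤ radius w + radius w′
    centres-close {w} {w′} w∈ w′∈ with v ≟ w′ | v ≟ w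
    ... | no v≢w′ | _ =
      subst (λ s → dist G w w′ ≤ radius w + s) (sym (radius-other (≢-sym v≢w′)))
        (centre-to-M w∈ (centre-in-M w′∈ (≢-sym v≢w′)))
    ... | yes refl | yes refl = dist-self v _
    ... | yes refl | no v≢w =
      subst₂ _≤_ (dist-sym v w)
        (trans (+-comm (radius v) r) (cong (_+ radius v) (sym (radius-other (≢-sym v≢w)))))
        (centre-to-M w′∈ (centre-in-M w∈ (≢-sym v≢w)))

    pairwise-intersecting : ∀ w w′ → w ∈ centres → w′ ∈ centres →
                            ∃[ u ] (Disk G w (radius w) u × Disk G w′ (radius w′) u)
    pairwise-intersecting w w′ w∈ w′∈ = disks-meet w w′ (radius w) (radius w′) (centres-close w∈ w′∈)

  close-to-center : ∀ v → ∃[ z ] (e z ≤ r + α × dist G v z ≤ (e v ∸ r) + α)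
  close-to-center v = from-helly (helly centres radius pairwise-intersecting)
    where
      open DisksAround v
      from-helly : ∃[ z ] (∀ w → w ∈ centres → Disk G w (radius w + α) z) →
                   ∃[ z ] (e z ≤ r + α × dist G v z ≤ (e v ∸ r) + α)
      from-helly (z , z-close) =
          z
        , ecc-≤ z (λ u u∈M → ≤-trans (z-close u (x∈p∪q⁺ (inj₁ u∈M))) (+-monoˡ-≤ α (radius-M u∈M)))
        , subst₂ _≤_ (dist-sym z v) (cong (_+ α) radius-v) (z-close v (x∈p∪q⁺ (inj₂ (x∈⁅x⁆ v))))

  far-ecc-bound : ∀ ℓ → α ≤ ℓ → ∀ {x y} → Far G M x y → 2 * r ∸ diam G (center G M ℓ) ∸ 2 * α ≤ e y
  far-ecc-bound ℓ α≤ℓ {x} {y} (_ , dxy≡ex) =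
    excess-arith {r} {e x} {e y} {D} {2 * α} (rad-≤ x) (rad-≤ y)
      (path-bound (close-to-center x) (close-to-center y))
    where
      open ≤-Reasoning
      D : ℕ
      D = diam G (center G M ℓ)

      in-center : ∀ {z} → e z ≤ r + α → center G M ℓ z ≡ true
      in-center ez≤ = ∈-center ℓ (≤-trans ez≤ (+-monoʳ-≤ r α≤ℓ))

      path-bound : ∃[ z ] (e z ≤ r + α × dist G x z ≤ (e x ∸ r) + α) →
                   ∃[ z ] (e z ≤ r + α × dist G y z ≤ (e y ∸ r) + α) →
                   e x ≤ (e x ∸ r) + (D + (2 * α + (e y ∸ r)))
      path-bound (zx , ezx , dx) (zy , ezy , dy) = begin
        e x                                        ≡⟨ sym dxy≡ex ⟩
        dist G x y                                 ≤⟨ dist-triangle x zx y ⟩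
        dist G x zx + dist G zx y                  ≤⟨ +-monoʳ-≤ (dist G x zx) (dist-triangle zx zy y) ⟩
        dist G x zx + (dist G zx zy + dist G zy y) ≤⟨ +-mono-≤ dx (+-mono-≤ (diam-≥ (center G M ℓ) (in-center ezx) (in-center ezy))
                                                                         (subst (_≤ e y ∸ r + α) (dist-sym y zy) dy)) ⟩
        (e x ∸ r + α) + (D + (e y ∸ r + α))        ≡⟨ regroup (e x ∸ r) α D (e y ∸ r) ⟩
        (e x ∸ r) + (D + (2 * α + (e y ∸ r)))      ∎

theorem6 : (G : Graph) → Connected G → (α : ℕ) → WeaklyHelly G α →
    (M : Subset (Graph.n G)) (x y : V G) → Far G M x y →
    (ecc G M y ≥ 2 * rad G M ∸ diam G (center G M (2 * α)) ∸ 2 * α)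
    × (ecc G M y ≥ 2 * rad G M ∸ diam G (center G M α) ∸ 4 * α)
theorem6 G conn α helly M x y far =
    far-ecc-bound (2 * α) α≤2α far
  , ≤-trans (∸-monoʳ-≤ _ 2α≤4α) (far-ecc-bound α ≤-refl far)
  where
    open HellyCenter G conn α helly M
    α≤2α : α ≤ 2 * α
    α≤2α = m≤m+n α (α + 0)
    2α≤4α : 2 * α ≤ 4 * α
    2α≤4α = *-monoˡ-≤ α {2} {4} (s≤s (s≤s z≤n))
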